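{- Consider an instance of $m$-RCSP on an $n$-vertex graph ($n\ge2$) and tolerances $\varepsilon_1,\dots,\varepsilon_m$ with $\varepsilon_iL_i>0$. Let $\Delta_i=\varepsilon_iL_i/(n-1)$ and for each edge $e$ let $\bar w_i(e)=d_i(e)\Delta_i$, where $d_i(e)$ is the integer with $(d_i(e)-1)\Delta_i<w_i(e)\le d_i(e)\Delta_i$. Consider the original problem $\min\{c(P): w_i(P)\le L_i,\ i=1,\dots,m\}$ and the scaled problem $\min\{c(P):\bar w_i(P)\le(1+\varepsilon_i)L_i,\ i=1,\dots,m\}$, both over simple directed $s\leadsto t$ paths $P$, where $w_i(P)=\sum_{e\in P}w_i(e)$ and $\bar w_i(P)=\sum_{e\in P}\bar w_i(e)$. If the original problem has a feasible solution, then the scaled problem has a feasible solution; moreover, in that case any optimal solution $P$ of the scaled problem satisfies $c(P)\le\mathrm{OPT}_{RCSP}$ and $w_i(P)\le(1+\varepsilon_i)L_i$ for all $i$.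
   Context: $m$-RCSP: an $n$-vertex directed graph $G=(V,E)$ with edge costs $c:E\to\mathbb{R}_{\ge0}$, $s,t\in V$, budgets $(L_1,\dots,L_m)\in(\mathbb{R}\setminus\{0\})^m$, per-edge resource vectors $(w_1(e),\dots,w_m(e))\in\mathbb{R}^m$ with no directed cycle of negative total $w_i$-weight for any $i$; $c(P)=\sum_{e\in P}c(e)$; $\mathrm{OPT}_{RCSP}$ is the minimum cost of an $s\leadsto t$ path $P$ with $w_i(P)\le L_i$ for all $i$.
   Formalization: The edge costs, the budgets $L_i$, the resources $w_i(e)$ and the tolerances ε_i are rational rather than real. -}

module Defs where

open import Data.Nat using (ℕ; zero; suc)
open import Data.Fin using (Fin)
open import Data.Integer using (ℤ; +_)
open import Data.Rational using (ℚ; 0ℚ; 1ℚ; _+_; _*_; _-_; _/_; _≤_; _<_)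
open import Data.List using (List; []; _∷_; map; foldr)
open import Data.List.Relation.Unary.Unique.Propositional using (Unique)
open import Data.Product using (Σ; _×_)

record Graph (n : ℕ) : Set where
  field
    nE  : ℕ
    src : Fin nE → Fin n
    tgt : Fin nE → Fin n

module _ {n : ℕ} (G : Graph n) where
  open Graph G

  Edge : Set
  Edge = Fin nE

  data Walk : Fin n → Fin n → Set where
    []  : ∀ {u} → Walk u u
    _∷_ : ∀ {v} (e : Edge) → Walk (tgt e) v → Walk (src e) v

  edges : ∀ {u v} → Walk u v → List Edge
  edges []      = []
  edges (e ∷ p) = e ∷ edges p

  verts : ∀ {u v} → Walk u v → List (Fin n)
  verts {u} []      = u ∷ []
  verts (e ∷ p)     = src e ∷ verts p

  SimplePath : Fin n → Fin n → Set
  SimplePath u v = Σ (Walk u v) (λ p → Unique (verts p))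

  -- directed cycle: nonempty closed walk e ∷ q visiting distinct vertices
  -- (the vertex list of q already contains every vertex of the cycle exactly once)
  data IsCycle : ∀ {u} → Walk u u → Set where
    cyc : ∀ (e : Edge) (q : Walk (tgt e) (src e)) → Unique (verts q) → IsCycle (e ∷ q)

  weight : (Edge → ℚ) → ∀ {u v} → Walk u v → ℚ
  weight f p = foldr _+_ 0ℚ (map f (edges p))

-- Δ = x / (n - 1) (only used for n ≥ 2; the value for n < 2 is irrelevant)
divByNm1 : ℕ → ℚ → ℚ
divByNm1 (suc (suc k)) x = x * ((+ 1) / suc k)
divByNm1 _             x = x

-- A simple path visits at most n vertices, so it has at most n - 1 edges, and rounding
-- every w_i(e) up to a multiple of Δ_i adds less than Δ_i per edge. Hence
-- w̄_i(P) ≤ w_i(P) + (n - 1) Δ_i = w_i(P) + ε_i L_i for every simple path: originally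
-- feasible paths are feasible for the scaled problem, which is therefore a relaxation,
-- and w_i ≤ w̄_i bounds w_i(P) by (1 + ε_i) L_i.
module Submission where

open import Defs
open import Data.Nat using (ℕ)
open import Data.Fin using (Fin)
open import Data.Integer using (ℤ)
open import Data.Rational using (ℚ; 0ℚ; 1ℚ; _+_; _*_; _/_; _≤_; _<_)
open import Data.Product using (Σ; _×_; proj₁)
open import Relation.Binary.PropositionalEquality using (_≢_)

open import Algebra.Bundles using (AbelianGroup)
import Data.Fin as Fin
open import Data.Fin.Properties using (injective⇒≤)
import Data.Integer as ℤ
import Data.Integer.Properties as ℤ
open import Data.List using (List; []; _∷_; length; lookup)
open import Data.List.Membership.Propositional.Properties using (∈-lookup)
open import Data.List.Relation.Unary.All as All using ()
open import Data.List.Relation.Unary.AllPairs using (_∷_)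
open import Data.List.Relation.Unary.Unique.Propositional using (Unique)
import Data.Nat as ℕ
import Data.Nat.Coprimality as Coprime
import Data.Nat.Properties as ℕ
open import Data.Product using (_,_; proj₂)
open import Data.Rational using (mkℚ; 1/_; NonNegative; nonNegative; *≤*)
import Data.Rational.Properties as ℚ
open import Data.Rational.Solver using (module +-*-Solver)
open import Function using (_∘_; Injective)
open import Relation.Binary.PropositionalEquality
  using (_≡_; refl; sym; trans; cong; cong₂; subst; subst₂; module ≡-Reasoning)
open import Relation.Nullary using (contradiction)

open import Algebra.Properties.Group (AbelianGroup.group ℤ.+-0-abelianGroup)
  using (//-rightDividesˡ)

lookup-injective : ∀ {A : Set} {xs : List A} → Unique xs → Injective _≡_ _≡_ (lookup xs)
lookup-injective (_ ∷ _)  {Fin.zero}  {Fin.zero}  _  = refl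
lookup-injective (x∉ ∷ _) {Fin.zero}  {Fin.suc j} eq = contradiction eq (All.lookup x∉ (∈-lookup j))
lookup-injective (x∉ ∷ _) {Fin.suc i} {Fin.zero}  eq = contradiction (sym eq) (All.lookup x∉ (∈-lookup i))
lookup-injective (_ ∷ u)  {Fin.suc i} {Fin.suc j} eq = cong Fin.suc (lookup-injective u eq)

length-unique-≤ : ∀ {n} {xs : List (Fin n)} → Unique xs → length xs ℕ.≤ n
length-unique-≤ = injective⇒≤ ∘ lookup-injective

/1≡mkℚ : ∀ i → i / 1 ≡ mkℚ i 0 (Coprime.sym (Coprime.1-coprimeTo _))
/1≡mkℚ i = ℚ.↥p/↧p≡p (mkℚ i 0 _)

/1-homo-+ : ∀ i j → (i ℤ.+ j) / 1 ≡ i / 1 + j / 1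
/1-homo-+ i j rewrite /1≡mkℚ i | /1≡mkℚ j =
  sym (cong (_/ 1) (cong₂ ℤ._+_ (ℤ.*-identityʳ i) (ℤ.*-identityʳ j)))

/1-mono-≤ : ∀ {i j} → i ℤ.≤ j → i / 1 ≤ j / 1
/1-mono-≤ {i} {j} i≤j rewrite /1≡mkℚ i | /1≡mkℚ j =
  *≤* (subst₂ ℤ._≤_ (sym (ℤ.*-identityʳ i)) (sym (ℤ.*-identityʳ j)) i≤j)

pred/1+1≡/1 : ∀ i → (i ℤ.- ℤ.1ℤ) / 1 + 1ℚ ≡ i / 1
pred/1+1≡/1 i = trans (sym (/1-homo-+ (i ℤ.- ℤ.1ℤ) ℤ.1ℤ)) (cong (_/ 1) (//-rightDividesˡ ℤ.1ℤ i))

divByNm1-nonNeg : ∀ n {x} → 0ℚ ≤ x → 0ℚ ≤ divByNm1 n x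
divByNm1-nonNeg ℕ.zero                0≤x = 0≤x
divByNm1-nonNeg (ℕ.suc ℕ.zero)         0≤x = 0≤x
divByNm1-nonNeg (ℕ.suc (ℕ.suc k)) {x} 0≤x
  rewrite ℚ.normalize-coprime {1} {k} (Coprime.1-coprimeTo _) =
  ℚ.nonNegative⁻¹ _ {{ℚ.nonNeg*nonNeg⇒nonNeg x {{nonNegative 0≤x}} (mkℚ (ℤ.+ 1) k _)}}

divByNm1-inverse : ∀ k x → (ℤ.+ ℕ.suc k / 1) * divByNm1 (ℕ.suc (ℕ.suc k)) x ≡ x
divByNm1-inverse k x rewrite /1≡mkℚ (ℤ.+ ℕ.suc k) | ℚ.normalize-coprime {1} {k} (Coprime.1-coprimeTo _) =
  begin
    p * (x * 1/ p) ≡⟨ ℚ.*-comm p (x * 1/ p) ⟩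
    x * 1/ p * p   ≡⟨ ℚ.*-assoc x (1/ p) p ⟩
    x * (1/ p * p) ≡⟨ cong (x *_) (ℚ.*-inverseˡ p) ⟩
    x * 1ℚ         ≡⟨ ℚ.*-identityʳ x ⟩
    x              ∎
  where
  open ≡-Reasoning
  p = mkℚ (ℤ.+ ℕ.suc k) 0 _

roundUp-≤-+ : ∀ d Δ x → ((d ℤ.- ℤ.1ℤ) / 1) * Δ < x → (d / 1) * Δ ≤ x + Δ
roundUp-≤-+ d Δ x [d-1]Δ<x = begin
  (d / 1) * Δ          ≡⟨ cong (_* Δ) (pred/1+1≡/1 d) ⟨
  (d-1 + 1ℚ) * Δ       ≡⟨ ℚ.*-distribʳ-+ Δ d-1 1ℚ ⟩
  d-1 * Δ + 1ℚ * Δ     ≡⟨ cong (d-1 * Δ +_) (ℚ.*-identityˡ Δ) ⟩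
  d-1 * Δ + Δ          ≤⟨ ℚ.+-monoˡ-≤ Δ (ℚ.<⇒≤ [d-1]Δ<x) ⟩
  x + Δ                ∎
  where
  open ℚ.≤-Reasoning
  d-1 = (d ℤ.- ℤ.1ℤ) / 1

module _ {n} (G : Graph n) where

  length-verts : ∀ {u v} (p : Walk G u v) → length (verts G p) ≡ ℕ.suc (length (edges G p))
  length-verts []      = refl
  length-verts (e ∷ p) = cong ℕ.suc (length-verts p)

  simplePath-length-< : ∀ {u v} (P : SimplePath G u v) → length (edges G (proj₁ P)) ℕ.< n
  simplePath-length-< (p , unique) = subst (ℕ._≤ n) (length-verts p) (length-unique-≤ unique)

  weight-mono : ∀ {f g} → (∀ e → f e ≤ g e) → ∀ {u v} (p : Walk G u v) → weight G f p ≤ weight G g p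
  weight-mono f≤g []      = ℚ.≤-refl
  weight-mono f≤g (e ∷ p) = ℚ.+-mono-≤ (f≤g e) (weight-mono f≤g p)

  weight-≤-+-length* : ∀ {f g Δ} → (∀ e → f e ≤ g e + Δ) → ∀ {u v} (p : Walk G u v) →
                       weight G f p ≤ weight G g p + (ℤ.+ length (edges G p) / 1) * Δ
  weight-≤-+-length* {Δ = Δ} f≤g+Δ [] =
    ℚ.≤-reflexive (sym (trans (cong (0ℚ +_) (ℚ.*-zeroˡ Δ)) (ℚ.+-identityʳ 0ℚ)))
  weight-≤-+-length* {f} {g} {Δ} f≤g+Δ (e ∷ p) = begin
    f e + weight G f p                           ≤⟨ ℚ.+-mono-≤ (f≤g+Δ e) (weight-≤-+-length* f≤g+Δ p) ⟩
    (g e + Δ) + (weight G g p + k/1 * Δ)         ≡⟨ regroup (g e) Δ (weight G g p) k/1 ⟩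
    (g e + weight G g p) + (1ℚ + k/1) * Δ        ≡⟨ cong (λ z → g e + weight G g p + z * Δ) (/1-homo-+ ℤ.1ℤ (ℤ.+ k)) ⟨
    (g e + weight G g p) + (ℤ.+ ℕ.suc k / 1) * Δ ∎
    where
    open ℚ.≤-Reasoning
    k = length (edges G p)
    k/1 = ℤ.+ k / 1
    regroup : ∀ a x b k → (a + x) + (b + k * x) ≡ (a + b) + (1ℚ + k) * x
    regroup = solve 4 (λ a x b k → (a :+ x) :+ (b :+ k :* x) := (a :+ b) :+ (con 1ℚ :+ k) :* x) refl
      where open +-*-Solver

simplePath-weight-≤-+ : ∀ {k} (G : Graph (ℕ.suc (ℕ.suc k))) {f g x} → 0ℚ ≤ x →
  (∀ e → f e ≤ g e + divByNm1 (ℕ.suc (ℕ.suc k)) x) →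
  ∀ {u v} (P : SimplePath G u v) → weight G f (proj₁ P) ≤ weight G g (proj₁ P) + x
simplePath-weight-≤-+ {k} G {f} {g} {x} 0≤x f≤g+Δ P@(p , _) = begin
  weight G f p                         ≤⟨ weight-≤-+-length* G f≤g+Δ p ⟩
  weight G g p + ‖p‖/1 * Δ             ≤⟨ ℚ.+-monoʳ-≤ (weight G g p) (ℚ.*-monoʳ-≤-nonNeg Δ ‖p‖≤n-1) ⟩
  weight G g p + (ℤ.+ ℕ.suc k / 1) * Δ ≡⟨ cong (weight G g p +_) (divByNm1-inverse k x) ⟩
  weight G g p + x                     ∎
  where
  open ℚ.≤-Reasoning
  Δ = divByNm1 (ℕ.suc (ℕ.suc k)) x
  instance
    Δ-nonNeg : NonNegative Δ
    Δ-nonNeg = nonNegative (divByNm1-nonNeg (ℕ.suc (ℕ.suc k)) 0≤x)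
  ‖p‖/1 = ℤ.+ length (edges G p) / 1
  ‖p‖≤n-1 : ‖p‖/1 ≤ ℤ.+ ℕ.suc k / 1
  ‖p‖≤n-1 = /1-mono-≤ (ℤ.+≤+ (ℕ.≤-pred (simplePath-length-< G P)))

lemma5p1 :
  (n : ℕ) → 2 Data.Nat.≤ n →
  (G : Graph n) → (s t : Fin n) →
  (c : Edge G → ℚ) → (∀ e → 0ℚ ≤ c e) →
  (m : ℕ) → (L : Fin m → ℚ) → (∀ i → L i ≢ 0ℚ) →
  (w : Fin m → Edge G → ℚ) →
  (∀ i u (C : Walk G u u) → IsCycle G C → 0ℚ ≤ weight G (w i) C) →
  (ε : Fin m → ℚ) → (∀ i → 0ℚ < ε i * L i) →
  (d : Fin m → Edge G → ℤ) →
  (∀ i e → ((d i e Data.Integer.- Data.Integer.1ℤ) / 1) * divByNm1 n (ε i * L i) < w i e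
         × w i e ≤ (d i e / 1) * divByNm1 n (ε i * L i)) →
  let wbar : Fin m → Edge G → ℚ
      wbar = λ i e → (d i e / 1) * divByNm1 n (ε i * L i)
      Orig : SimplePath G s t → Set
      Orig = λ P → ∀ i → weight G (w i) (proj₁ P) ≤ L i
      Scaled : SimplePath G s t → Set
      Scaled = λ P → ∀ i → weight G (wbar i) (proj₁ P) ≤ (1ℚ + ε i) * L i
  in Σ (SimplePath G s t) Orig →
     Σ (SimplePath G s t) Scaled
     × (∀ (P : SimplePath G s t) → Scaled P →
          (∀ (Q : SimplePath G s t) → Scaled Q → weight G c (proj₁ P) ≤ weight G c (proj₁ Q)) →
          (∀ (Q : SimplePath G s t) → Orig Q → weight G c (proj₁ P) ≤ weight G c (proj₁ Q))
          × (∀ i → weight G (w i) (proj₁ P) ≤ (1ℚ + ε i) * L i))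
lemma5p1 n@(ℕ.suc (ℕ.suc _)) (ℕ.s≤s (ℕ.s≤s ℕ.z≤n)) G s t c _ m L _ w _ ε 0<εL d d-bounds (Q , Q-orig) =
  (Q , orig⇒scaled Q Q-orig) ,
  λ P P-scaled P-optimal →
    (λ R R-orig → P-optimal R (orig⇒scaled R R-orig)) ,
    (λ i → ℚ.≤-trans (weight-mono G (proj₂ ∘ d-bounds i) (proj₁ P)) (P-scaled i))
  where
  wbar : Fin m → Edge G → ℚ
  wbar i e = (d i e / 1) * divByNm1 n (ε i * L i)

  orig⇒scaled : (P : SimplePath G s t) → (∀ i → weight G (w i) (proj₁ P) ≤ L i) →
                ∀ i → weight G (wbar i) (proj₁ P) ≤ (1ℚ + ε i) * L i
  orig⇒scaled P P-orig i = begin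
    weight G (wbar i) (proj₁ P)          ≤⟨ simplePath-weight-≤-+ G (ℚ.<⇒≤ (0<εL i)) wbar≤w+Δ P ⟩
    weight G (w i) (proj₁ P) + ε i * L i ≤⟨ ℚ.+-monoˡ-≤ (ε i * L i) (P-orig i) ⟩
    L i + ε i * L i                      ≡⟨ cong (_+ ε i * L i) (ℚ.*-identityˡ (L i)) ⟨
    1ℚ * L i + ε i * L i                 ≡⟨ ℚ.*-distribʳ-+ (L i) 1ℚ (ε i) ⟨
    (1ℚ + ε i) * L i                     ∎
    where
    open ℚ.≤-Reasoning
    wbar≤w+Δ : ∀ e → wbar i e ≤ w i e + divByNm1 n (ε i * L i)
    wbar≤w+Δ e = roundUp-≤-+ (d i e) _ (w i e) (proj₁ (d-bounds i e))
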